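{- For every $k \geq 2$ and every $n \geq 2$, the DCell graph $D_{k,n}$ is not vertex-transitive.
   Context: DCell graphs $D_{k,n}$ ($k \geq 0$, $n \geq 2$) are defined recursively. $D_{0,n}$ is the complete graph $K_n$ on vertices labeled $0,1,\dots,n-1$. Let $t_{k,n}$ denote the number of vertices of $D_{k,n}$. For $k \geq 1$, $D_{k,n}$ consists of $t_{k-1,n}+1$ disjoint copies $D^i_{k-1,n}$, $i = 0,1,\dots,t_{k-1,n}$, of $D_{k-1,n}$; a vertex of $D^i_{k-1,n}$ is labeled $(i,a_{k-1},\dots,a_0)$, where $(a_{k-1},\dots,a_0)$ is its label in $D_{k-1,n}$. For a suffix $(a_j,\dots,a_0)$ define $uid_j = a_0 + \sum_{l=1}^{j} a_l\, t_{l-1,n}$. Besides the edges inside the copies, for every pair $a<b$ of copy indices there is exactly one additional edge, joining the vertex of $D^a_{k-1,n}$ whose suffix has $uid_{k-1} = b-1$ to the vertex of $D^b_{k-1,n}$ whose suffix has $uid_{k-1} = a$. A graph is vertex-transitive if its automorphism group acts transitively on its vertices. -}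

module Defs where

open import Level using (0ℓ)
open import Data.Nat using (ℕ; zero; suc; _+_; _*_; _∸_; _<_)
open import Data.Fin using (Fin; toℕ)
open import Data.Product using (Σ; _×_; _,_; ∃)
open import Data.Sum using (_⊎_)
open import Relation.Binary.PropositionalEquality using (_≡_; _≢_)
open import Function.Bundles using (_↔_; Inverse)

-- t k n : number of vertices of D_{k,n}
t : ℕ → ℕ → ℕ
t zero    n = n
t (suc k) n = (t k n + 1) * t k n

-- Vertex labels of D_{k,n}: D_{0,n} has labels 0..n-1;
-- a vertex of D_{k+1,n} is (i , (a_k,...,a_0)) with i a copy index in 0..t_{k,n}.
Vertex : ℕ → ℕ → Set
Vertex zero    n = Fin n
Vertex (suc k) n = Fin (t k n + 1) × Vertex k n

uid : (k n : ℕ) → Vertex k n → ℕ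
uid zero    n a       = toℕ a
uid (suc k) n (i , v) = uid k n v + toℕ i * t k n

Adj : (k n : ℕ) → Vertex k n → Vertex k n → Set
Adj zero    n a b = a ≢ b
Adj (suc k) n (i , u) (j , v) =
    (i ≡ j × Adj k n u v)
  ⊎ ((toℕ i < toℕ j × uid k n u ≡ toℕ j ∸ 1 × uid k n v ≡ toℕ i)
  ⊎  (toℕ j < toℕ i × uid k n v ≡ toℕ i ∸ 1 × uid k n u ≡ toℕ j))

IsAutomorphism : {V : Set} → (E : V → V → Set) → V ↔ V → Set
IsAutomorphism {V} E f =
  ∀ (u v : V) → (E u v → E (Inverse.to f u) (Inverse.to f v))
              × (E (Inverse.to f u) (Inverse.to f v) → E u v)

VertexTransitive : (V : Set) → (E : V → V → Set) → Set
VertexTransitive V E =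
  ∀ (u v : V) → Σ (V ↔ V) (λ f → IsAutomorphism E f × Inverse.to f u ≡ v)

-- Call an edge a b hexagonal if it closes up a walk b x₁ x₂ x₃ x₄ a whose inner vertices (not
-- necessarily distinct) avoid a and b; automorphisms preserve hexagonal edges.  In D_{k,n} every
-- edge at the origin 0…0 is hexagonal: an edge inside copy 0 inherits a hexagon from D_{k-1,n}
-- (for k = 1 take the walk through copies y+1 and 1), and the edge to copy 1 closes a walk through
-- copies 1, 2 and 0.  For k ≥ 2 the edge between copy 0 and the last copy T = t_{k-1,n} is not
-- hexagonal: a walk of length three from copy T to copy 0 avoiding the ends of that edge needs a
-- vertex whose uid is both T - 1 and 0, or an edge of D_{k-1,n} between its vertices of uid T - 1
-- and 0, and neither exists.
module Submission where

open import Defs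
open import Data.Empty using (⊥; ⊥-elim)
open import Data.Fin using (Fin; toℕ; fromℕ; fromℕ<)
import Data.Fin as Fin
open import Data.Fin.Properties using (toℕ<n; toℕ-fromℕ; toℕ-fromℕ<; toℕ-injective)
open import Data.Nat using (ℕ; zero; suc; _+_; _*_; _∸_; _≤_; _<_; z≤n; s≤s; NonZero; >-nonZero)
open import Data.Nat.DivMod using (_/_; +-distrib-/-∣ʳ; m<n⇒m/n≡0; m*n/n≡m)
open import Data.Nat.Divisibility using (divides-refl)
open import Data.Nat.Properties
open import Data.Product using (_×_; _,_; proj₁; proj₂)
open import Data.Sum using (_⊎_; inj₁; inj₂)
import Data.Sum as Sum
open import Function using (_∘_)
open import Function.Bundles using (Inverse)
open import Relation.Binary.Definitions using (tri<; tri≈; tri>)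
open import Relation.Nullary using (¬_; yes; no)
open import Relation.Binary.PropositionalEquality

record Hexagon {V : Set} (E : V → V → Set) (a b : V) : Set where
  field
    x₁ x₂ x₃ x₄ : V
    b-x₁  : E b x₁
    x₁-x₂ : E x₁ x₂
    x₂-x₃ : E x₂ x₃
    x₃-x₄ : E x₃ x₄
    x₄-a  : E x₄ a
    x₁≢a : x₁ ≢ a
    x₁≢b : x₁ ≢ b
    x₂≢a : x₂ ≢ a
    x₂≢b : x₂ ≢ b
    x₃≢a : x₃ ≢ a
    x₃≢b : x₃ ≢ b
    x₄≢a : x₄ ≢ a
    x₄≢b : x₄ ≢ b

Hexagon-map : ∀ {V W : Set} {E : V → V → Set} {F : W → W → Set} (g : V → W) →
              (∀ {p q} → E p q → F (g p) (g q)) → (∀ {p q} → g p ≡ g q → p ≡ q) →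
              ∀ {a b} → Hexagon E a b → Hexagon F (g a) (g b)
Hexagon-map g g-hom g-inj h = record
  { x₁ = g x₁ ; x₂ = g x₂ ; x₃ = g x₃ ; x₄ = g x₄
  ; b-x₁ = g-hom b-x₁ ; x₁-x₂ = g-hom x₁-x₂ ; x₂-x₃ = g-hom x₂-x₃
  ; x₃-x₄ = g-hom x₃-x₄ ; x₄-a = g-hom x₄-a
  ; x₁≢a = x₁≢a ∘ g-inj ; x₁≢b = x₁≢b ∘ g-inj ; x₂≢a = x₂≢a ∘ g-inj ; x₂≢b = x₂≢b ∘ g-inj
  ; x₃≢a = x₃≢a ∘ g-inj ; x₃≢b = x₃≢b ∘ g-inj ; x₄≢a = x₄≢a ∘ g-inj ; x₄≢b = x₄≢b ∘ g-inj
  }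
  where open Hexagon h

HexagonalAt : {V : Set} → (V → V → Set) → V → Set
HexagonalAt E v = ∀ w → E v w → Hexagon E v w

¬VertexTransitive : ∀ {V : Set} {E : V → V → Set} {u v w : V} →
                    HexagonalAt E v → E u w → ¬ Hexagon E u w → ¬ VertexTransitive V E
¬VertexTransitive {E = E} {u} {v} {w} hexagonal-v u-w no-hexagon vt with vt u v
... | f , aut , refl =
  no-hexagon (subst₂ (Hexagon E) (strictlyInverseʳ u) (strictlyInverseʳ w)
    (Hexagon-map from from-hom from-injective
      (hexagonal-v (to w) (proj₁ (aut u w) u-w))))
  where
  open Inverse f
  from-hom : ∀ {p q} → E p q → E (from p) (from q)
  from-hom {p} {q} p-q = proj₂ (aut (from p) (from q))
    (subst₂ E (sym (strictlyInverseˡ p)) (sym (strictlyInverseˡ q)) p-q)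
  from-injective : ∀ {p q} → from p ≡ from q → p ≡ q
  from-injective {p} {q} eq = trans (sym (strictlyInverseˡ p)) (trans (cong to eq) (strictlyInverseˡ q))

mixedRadix-injective : ∀ {s a b} i j → a < s → b < s → a + i * s ≡ b + j * s → a ≡ b × i ≡ j
mixedRadix-injective {s} {a} {b} i j a<s b<s eq =
  +-cancelʳ-≡ (i * s) a b (trans eq (cong (λ k → b + k * s) (sym i≡j))) , i≡j
  where
  instance
    s≢0 : NonZero s
    s≢0 = >-nonZero (≤-trans (s≤s z≤n) a<s)

  quotient : ∀ {c} k → c < s → (c + k * s) / s ≡ k
  quotient {c} k c<s = begin
    (c + k * s) / s      ≡⟨ +-distrib-/-∣ʳ c (divides-refl k) ⟩
    c / s + k * s / s    ≡⟨ cong₂ _+_ (m<n⇒m/n≡0 c<s) (m*n/n≡m k s) ⟩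
    k                    ∎
    where open ≡-Reasoning

  i≡j : i ≡ j
  i≡j = trans (sym (quotient i a<s)) (trans (cong (_/ s) eq) (quotient j b<s))

[m+1]*m∸1≡m∸1+m*m : ∀ m → (m + 1) * m ∸ 1 ≡ m ∸ 1 + m * m
[m+1]*m∸1≡m∸1+m*m zero    = refl
[m+1]*m∸1≡m∸1+m*m (suc m) = cong (λ k → m + k * suc m) (+-comm m 1)

m<n⇒m≤n∸1 : ∀ {m n} → m < n → m ≤ n ∸ 1
m<n⇒m≤n∸1 (s≤s m≤n) = m≤n

toℕ≤ : ∀ {m} (i : Fin (m + 1)) → toℕ i ≤ m
toℕ≤ {m} i = m<1+n⇒m≤n (subst (toℕ i <_) (+-comm m 1) (toℕ<n i))

copy : ∀ {m} p → p ≤ m → Fin (m + 1)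
copy {m} p p≤m = fromℕ< (subst (p <_) (+-comm 1 m) (s≤s p≤m))

toℕ-copy : ∀ {m} p (p≤m : p ≤ m) → toℕ (copy p p≤m) ≡ p
toℕ-copy {m} p p≤m = toℕ-fromℕ< (subst (p <_) (+-comm 1 m) (s≤s p≤m))

module DCell (n : ℕ) where

  uid<t : ∀ k (v : Vertex k n) → uid k n v < t k n
  uid<t zero    v       = toℕ<n v
  uid<t (suc k) (i , v) = <-≤-trans (+-monoˡ-< (toℕ i * t k n) (uid<t k v))
                                    (*-monoˡ-≤ (t k n) (toℕ<n i))

  uid-injective : ∀ k {u v : Vertex k n} → uid k n u ≡ uid k n v → u ≡ v
  uid-injective zero    eq = toℕ-injective eq
  uid-injective (suc k) {i , u} {j , v} eq
    with mixedRadix-injective (toℕ i) (toℕ j) (uid<t k u) (uid<t k v) eq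
  ... | u≡v , i≡j = cong₂ _,_ (toℕ-injective i≡j) (uid-injective k u≡v)

  Adj-sym : ∀ k {u v : Vertex k n} → Adj k n u v → Adj k n v u
  Adj-sym zero    u≢v                 = u≢v ∘ sym
  Adj-sym (suc k) (inj₁ (refl , u-v)) = inj₁ (refl , Adj-sym k u-v)
  Adj-sym (suc k) (inj₂ (inj₁ up))    = inj₂ (inj₂ up)
  Adj-sym (suc k) (inj₂ (inj₂ down))  = inj₂ (inj₁ down)

  Adj-within : ∀ k {i j u v} → toℕ i ≡ toℕ j → Adj (suc k) n (i , u) (j , v) → Adj k n u v
  Adj-within k _   (inj₁ (_ , u-v))        = u-v
  Adj-within k i≡j (inj₂ (inj₁ (i<j , _))) = ⊥-elim (<-irrefl i≡j i<j)
  Adj-within k i≡j (inj₂ (inj₂ (j<i , _))) = ⊥-elim (<-irrefl (sym i≡j) j<i)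

  Adj-across : ∀ k {i j u v} → toℕ i < toℕ j → Adj (suc k) n (i , u) (j , v) →
               uid k n u ≡ toℕ j ∸ 1 × uid k n v ≡ toℕ i
  Adj-across k i<j (inj₁ (refl , _))        = ⊥-elim (<-irrefl refl i<j)
  Adj-across k _   (inj₂ (inj₁ (_ , uids))) = uids
  Adj-across k i<j (inj₂ (inj₂ (j<i , _)))  = ⊥-elim (<-asym i<j j<i)

  across : ∀ k {i j u v p q} → toℕ i ≡ p → toℕ j ≡ q → p < q →
           uid k n u ≡ q ∸ 1 → uid k n v ≡ p → Adj (suc k) n (i , u) (j , v)
  across k refl refl p<q u-uid v-uid = inj₂ (inj₁ (p<q , u-uid , v-uid))

  leave-top : ∀ k {i j u v} → toℕ i ≡ t k n → Adj (suc k) n (i , u) (j , v) →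
              toℕ j ≡ t k n ⊎ (toℕ j < t k n × uid k n v ≡ t k n ∸ 1 × uid k n u ≡ toℕ j)
  leave-top k {i} {j} i≡t e with m≤n⇒m<n∨m≡n (toℕ≤ j)
  ... | inj₂ j≡t = inj₁ j≡t
  ... | inj₁ j<t with Adj-across k (subst (toℕ j <_) (sym i≡t) j<t) (Adj-sym (suc k) e)
  ...   | v-uid , u-uid = inj₂ (j<t , trans v-uid (cong (_∸ 1) i≡t) , u-uid)

  enter-bottom : ∀ k {i j u v} → toℕ j ≡ 0 → Adj (suc k) n (i , u) (j , v) →
                 toℕ i ≡ 0 ⊎ (0 < toℕ i × uid k n u ≡ 0 × uid k n v ≡ toℕ i ∸ 1)
  enter-bottom k {i} j≡0 e with toℕ i ≟ 0
  ... | yes i≡0 = inj₁ i≡0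
  ... | no  i≢0 with Adj-across k (subst (_< toℕ i) (sym j≡0) (n≢0⇒n>0 i≢0)) (Adj-sym (suc k) e)
  ...   | v-uid , u-uid = inj₂ (n≢0⇒n>0 i≢0 , trans u-uid j≡0 , v-uid)

  ≢-copy : ∀ k {i j : Fin (t k n + 1)} {u v : Vertex k n} {p q} →
           toℕ i ≡ p → toℕ j ≡ q → p ≢ q → _≢_ {A = Vertex (suc k) n} (i , u) (j , v)
  ≢-copy k refl refl p≢q = p≢q ∘ cong (toℕ ∘ proj₁)

  ≢-uid : ∀ k {i j : Fin (t k n + 1)} {u v : Vertex k n} {p q} →
          uid k n u ≡ p → uid k n v ≡ q → p ≢ q → _≢_ {A = Vertex (suc k) n} (i , u) (j , v)
  ≢-uid k refl refl p≢q = p≢q ∘ cong (uid k n ∘ proj₂)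

module _ (n : ℕ) where
  private
    N : ℕ
    N = suc (suc n)

  open DCell N

  2≤t : ∀ k → 2 ≤ t k N
  2≤t zero    = s≤s (s≤s z≤n)
  2≤t (suc k) = ≤-trans (2≤t k)
    (subst (t k N ≤_) (cong (_* t k N) (+-comm 1 (t k N))) (m≤m+n (t k N) (t k N * t k N)))

  0<t : ∀ k → 0 < t k N
  0<t k = ≤-trans (s≤s z≤n) (2≤t k)

  t∸1≢0 : ∀ k → t k N ∸ 1 ≢ 0
  t∸1≢0 k eq = <-irrefl (sym eq) (m<n⇒m≤n∸1 (2≤t k))

  origin : ∀ k → Vertex k N
  origin zero    = Fin.zero
  origin (suc k) = copy 0 z≤n , origin k

  next : ∀ k → Vertex k N
  next zero    = Fin.suc Fin.zero
  next (suc k) = copy 0 z≤n , next k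

  last : ∀ k → Vertex k N
  last zero    = fromℕ (suc n)
  last (suc k) = copy (t k N) ≤-refl , last k

  uid-origin : ∀ k → uid k N (origin k) ≡ 0
  uid-origin zero    = refl
  uid-origin (suc k) = cong₂ (λ p c → p + c * t k N) (uid-origin k) (toℕ-copy {t k N} 0 z≤n)

  uid-next : ∀ k → uid k N (next k) ≡ 1
  uid-next zero    = refl
  uid-next (suc k) = cong₂ (λ p c → p + c * t k N) (uid-next k) (toℕ-copy {t k N} 0 z≤n)

  uid-last : ∀ k → uid k N (last k) ≡ t k N ∸ 1
  uid-last zero    = toℕ-fromℕ (suc n)
  uid-last (suc k) = begin
    uid k N (last k) + toℕ (copy (t k N) ≤-refl) * t k N
      ≡⟨ cong₂ (λ p c → p + c * t k N) (uid-last k) (toℕ-copy (t k N) ≤-refl) ⟩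
    t k N ∸ 1 + t k N * t k N
      ≡⟨ [m+1]*m∸1≡m∸1+m*m (t k N) ⟨
    (t k N + 1) * t k N ∸ 1 ∎
    where open ≡-Reasoning

  origin-next : ∀ k → Adj k N (origin k) (next k)
  origin-next zero    = λ ()
  origin-next (suc k) = inj₁ (refl , origin-next k)

  clique-hexagon : (y : Fin (suc n)) → Hexagon (Adj 1 N) (origin 1) (copy {N} 0 z≤n , Fin.suc y)
  clique-hexagon y = record
    { x₁ = cᵧ , Fin.zero ; x₂ = cᵧ , Fin.suc Fin.zero ; x₃ = c₁ , Fin.suc y ; x₄ = c₁ , Fin.zero
    ; b-x₁  = across 0 c₀-toℕ cᵧ-toℕ (s≤s z≤n) refl refl
    ; x₁-x₂ = inj₁ (refl , λ ())
    ; x₂-x₃ = Adj-sym 1 (across 0 c₁-toℕ cᵧ-toℕ (s≤s (s≤s z≤n)) refl refl)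
    ; x₃-x₄ = inj₁ (refl , λ ())
    ; x₄-a  = Adj-sym 1 (across 0 c₀-toℕ c₁-toℕ (s≤s z≤n) refl refl)
    ; x₁≢a = ≢-copy 0 cᵧ-toℕ c₀-toℕ (λ ()) ; x₁≢b = ≢-copy 0 cᵧ-toℕ c₀-toℕ (λ ())
    ; x₂≢a = ≢-copy 0 cᵧ-toℕ c₀-toℕ (λ ()) ; x₂≢b = ≢-copy 0 cᵧ-toℕ c₀-toℕ (λ ())
    ; x₃≢a = ≢-copy 0 c₁-toℕ c₀-toℕ (λ ()) ; x₃≢b = ≢-copy 0 c₁-toℕ c₀-toℕ (λ ())
    ; x₄≢a = ≢-copy 0 c₁-toℕ c₀-toℕ (λ ()) ; x₄≢b = ≢-copy 0 c₁-toℕ c₀-toℕ (λ ())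
    }
    where
    p = toℕ y
    c₀ c₁ cᵧ : Fin (N + 1)
    c₀ = copy {N} 0 z≤n
    c₁ = copy {N} 1 (s≤s z≤n)
    cᵧ = copy {N} (suc (suc p)) (toℕ<n (Fin.suc y))
    c₀-toℕ : toℕ c₀ ≡ 0
    c₀-toℕ = toℕ-copy {N} 0 z≤n
    c₁-toℕ : toℕ c₁ ≡ 1
    c₁-toℕ = toℕ-copy {N} 1 (s≤s z≤n)
    cᵧ-toℕ : toℕ cᵧ ≡ suc (suc p)
    cᵧ-toℕ = toℕ-copy {N} (suc (suc p)) (toℕ<n (Fin.suc y))

  level-hexagon : ∀ k → Hexagon (Adj (suc k) N) (origin (suc k)) (copy 1 (0<t k) , origin k)
  level-hexagon k = record
    { x₁ = c₁ , next k ; x₂ = c₂ , next k ; x₃ = c₂ , origin k ; x₄ = c₀ , next k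
    ; b-x₁  = inj₁ (refl , origin-next k)
    ; x₁-x₂ = across k c₁-toℕ c₂-toℕ (s≤s (s≤s z≤n)) (uid-next k) (uid-next k)
    ; x₂-x₃ = inj₁ (refl , Adj-sym k (origin-next k))
    ; x₃-x₄ = Adj-sym (suc k) (across k c₀-toℕ c₂-toℕ (s≤s z≤n) (uid-next k) (uid-origin k))
    ; x₄-a  = inj₁ (refl , Adj-sym k (origin-next k))
    ; x₁≢a = ≢-copy k c₁-toℕ c₀-toℕ (λ ()) ; x₁≢b = ≢-uid k (uid-next k) (uid-origin k) (λ ())
    ; x₂≢a = ≢-copy k c₂-toℕ c₀-toℕ (λ ()) ; x₂≢b = ≢-copy k c₂-toℕ c₁-toℕ (λ ())
    ; x₃≢a = ≢-copy k c₂-toℕ c₀-toℕ (λ ()) ; x₃≢b = ≢-copy k c₂-toℕ c₁-toℕ (λ ())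
    ; x₄≢a = ≢-uid k (uid-next k) (uid-origin k) (λ ()) ; x₄≢b = ≢-copy k c₀-toℕ c₁-toℕ (λ ())
    }
    where
    c₀ c₁ c₂ : Fin (t k N + 1)
    c₀ = copy 0 z≤n
    c₁ = copy 1 (0<t k)
    c₂ = copy 2 (2≤t k)
    c₀-toℕ : toℕ c₀ ≡ 0
    c₀-toℕ = toℕ-copy 0 z≤n
    c₁-toℕ : toℕ c₁ ≡ 1
    c₁-toℕ = toℕ-copy 1 (0<t k)
    c₂-toℕ : toℕ c₂ ≡ 2
    c₂-toℕ = toℕ-copy 2 (2≤t k)

  origin-hexagonal : ∀ k → HexagonalAt (Adj (suc k) N) (origin (suc k))
  origin-hexagonal zero    (_ , Fin.zero)  (inj₁ (_ , 0≢0)) = ⊥-elim (0≢0 refl)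
  origin-hexagonal zero    (_ , Fin.suc y) (inj₁ (refl , _)) = clique-hexagon y
  origin-hexagonal (suc k) (_ , y)         (inj₁ (refl , e)) =
    Hexagon-map (copy 0 z≤n ,_) (λ e → inj₁ (refl , e)) (cong proj₂) (origin-hexagonal k y e)
  origin-hexagonal k (j , y) (inj₂ (inj₁ (0<j , origin-uid , y-uid))) =
    subst₂ (λ j y → Hexagon (Adj (suc k) N) (origin (suc k)) (j , y)) (sym j≡c₁) (sym y≡origin)
           (level-hexagon k)
    where
    j≡1 : toℕ j ≡ 1
    j≡1 = ∸-cancelʳ-≡ (subst (_< toℕ j) (toℕ-copy 0 z≤n) 0<j) (s≤s z≤n)
                      (trans (sym origin-uid) (uid-origin k))
    j≡c₁ : j ≡ copy 1 (0<t k)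
    j≡c₁ = toℕ-injective (trans j≡1 (sym (toℕ-copy 1 (0<t k))))
    y≡origin : y ≡ origin k
    y≡origin = uid-injective k (trans y-uid (trans (toℕ-copy 0 z≤n) (sym (uid-origin k))))
  origin-hexagonal k (j , _) (inj₂ (inj₂ (j<0 , _))) =
    ⊥-elim (n≮0 (subst (toℕ j <_) (toℕ-copy 0 z≤n) j<0))

  last≁origin : ∀ m → ¬ Adj (suc m) N (last (suc m)) (origin (suc m))
  last≁origin m = λ where
      (inj₁ (cₜ≡c₀ , _)) → <-irrefl (sym (trans (sym cₜ-toℕ) (trans (cong toℕ cₜ≡c₀) c₀-toℕ))) (0<t m)
      (inj₂ (inj₁ (cₜ<c₀ , _))) → n≮0 (subst₂ _<_ cₜ-toℕ c₀-toℕ cₜ<c₀)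
      (inj₂ (inj₂ (_ , origin-uid , _))) →
        t∸1≢0 m (trans (cong (_∸ 1) (sym cₜ-toℕ)) (trans (sym origin-uid) (uid-origin m)))
    where
    cₜ-toℕ : toℕ (copy {t m N} (t m N) ≤-refl) ≡ t m N
    cₜ-toℕ = toℕ-copy (t m N) ≤-refl
    c₀-toℕ : toℕ (copy {t m N} 0 z≤n) ≡ 0
    c₀-toℕ = toℕ-copy 0 z≤n

  module BottomTopEdge (m : ℕ) where
    private
      K T : ℕ
      K = suc m
      T = t K N

    a b : Vertex (suc K) N
    a = copy 0 z≤n , last K
    b = copy T ≤-refl , origin K

    a-b : Adj (suc K) N a b
    a-b = across K (toℕ-copy 0 z≤n) (toℕ-copy T ≤-refl) (0<t K) (uid-last K) (uid-origin K)

    is-a : ∀ {i u} → toℕ i ≡ 0 → uid K N u ≡ T ∸ 1 → _≡_ {A = Vertex (suc K) N} (i , u) a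
    is-a i≡0 u-uid = cong₂ _,_ (toℕ-injective (trans i≡0 (sym (toℕ-copy 0 z≤n))))
                               (uid-injective K (trans u-uid (sym (uid-last K))))

    is-b : ∀ {i u} → toℕ i ≡ T → uid K N u ≡ 0 → _≡_ {A = Vertex (suc K) N} (i , u) b
    is-b i≡T u-uid = cong₂ _,_ (toℕ-injective (trans i≡T (sym (toℕ-copy T ≤-refl))))
                               (uid-injective K (trans u-uid (sym (uid-origin K))))

    b-neighbour : ∀ {x} → Adj (suc K) N b x → x ≢ a → toℕ (proj₁ x) ≡ T
    b-neighbour e x≢a with leave-top K (toℕ-copy T ≤-refl) e
    ... | inj₁ i≡T = i≡T
    ... | inj₂ (_ , x-uid , origin-uid) =
      ⊥-elim (x≢a (is-a (trans (sym origin-uid) (uid-origin K)) x-uid))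

    a-neighbour : ∀ {x} → Adj (suc K) N x a → x ≢ b → toℕ (proj₁ x) ≡ 0
    a-neighbour e x≢b with enter-bottom K (toℕ-copy 0 z≤n) e
    ... | inj₁ i≡0 = i≡0
    ... | inj₂ (0<i , x-uid , last-uid) =
      ⊥-elim (x≢b (is-b (∸-cancelʳ-≡ 0<i (0<t K) (trans (sym last-uid) (uid-last K))) x-uid))

    from-top : ∀ {i₂ u₂ i₃ u₃} → toℕ i₂ ≡ T → Adj (suc K) N (i₂ , u₂) (i₃ , u₃) →
               toℕ i₃ ≡ 0 ⊎ uid K N u₃ ≡ 0 → (i₃ , u₃) ≢ a → (i₃ , u₃) ≢ b → ⊥
    from-top i₂≡T e x₃-end x₃≢a x₃≢b with leave-top K i₂≡T e | x₃-end
    ... | inj₁ i₃≡T             | inj₁ i₃≡0 = <-irrefl (trans (sym i₃≡0) i₃≡T) (0<t K)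
    ... | inj₁ i₃≡T             | inj₂ u₃≡0 = x₃≢b (is-b i₃≡T u₃≡0)
    ... | inj₂ (_ , u₃-uid , _) | inj₁ i₃≡0 = x₃≢a (is-a i₃≡0 u₃-uid)
    ... | inj₂ (_ , u₃-uid , _) | inj₂ u₃≡0 = t∸1≢0 K (trans (sym u₃-uid) u₃≡0)

    into-bottom : ∀ {i₂ u₂ i₃ u₃} → toℕ i₃ ≡ 0 → Adj (suc K) N (i₂ , u₂) (i₃ , u₃) →
                  uid K N u₂ ≡ T ∸ 1 → (i₂ , u₂) ≢ a → ⊥
    into-bottom i₃≡0 e u₂-uid x₂≢a with enter-bottom K i₃≡0 e
    ... | inj₁ i₂≡0           = x₂≢a (is-a i₂≡0 u₂-uid)
    ... | inj₂ (_ , u₂≡0 , _) = t∸1≢0 K (trans (sym u₂-uid) u₂≡0)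

    between : ∀ {i₂ u₂ i₃ u₃} → toℕ i₂ < T → 0 < toℕ i₃ → uid K N u₂ ≡ T ∸ 1 → uid K N u₃ ≡ 0 →
              Adj (suc K) N (i₂ , u₂) (i₃ , u₃) → (i₃ , u₃) ≢ b → ⊥
    between {i₂} {_} {i₃} i₂<T 0<i₃ u₂-uid u₃-uid e x₃≢b with <-cmp (toℕ i₂) (toℕ i₃)
    ... | tri≈ _ i₂≡i₃ _ =
      last≁origin m (subst₂ (Adj K N) (uid-injective K (trans u₂-uid (sym (uid-last K))))
                                      (uid-injective K (trans u₃-uid (sym (uid-origin K))))
                                      (Adj-within K i₂≡i₃ e))
    ... | tri< i₂<i₃ _ _ =
      x₃≢b (is-b (∸-cancelʳ-≡ 0<i₃ (0<t K) (trans (sym (proj₁ (Adj-across K i₂<i₃ e))) u₂-uid)) u₃-uid)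
    ... | tri> _ _ i₃<i₂ =
      <⇒≱ i₃<i₂ (subst (toℕ i₂ ≤_) (trans (sym u₂-uid) (proj₂ (Adj-across K i₃<i₂ (Adj-sym (suc K) e))))
                                    (m<n⇒m≤n∸1 i₂<T))

    no-short-walk : ∀ {x₁ x₂ x₃ x₄} → toℕ (proj₁ x₁) ≡ T → toℕ (proj₁ x₄) ≡ 0 →
                    Adj (suc K) N x₁ x₂ → Adj (suc K) N x₂ x₃ → Adj (suc K) N x₃ x₄ →
                    x₂ ≢ a → x₃ ≢ a → x₃ ≢ b → ⊥
    no-short-walk i₁≡T i₄≡0 e₁ e₂ e₃ x₂≢a x₃≢a x₃≢b with leave-top K i₁≡T e₁ | enter-bottom K i₄≡0 e₃
    ... | inj₁ i₂≡T                | x₃-end =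
      from-top i₂≡T e₂ (Sum.map₂ (proj₁ ∘ proj₂) x₃-end) x₃≢a x₃≢b
    ... | inj₂ (_ , u₂-uid , _)    | inj₁ i₃≡0 =
      into-bottom i₃≡0 e₂ u₂-uid x₂≢a
    ... | inj₂ (i₂<T , u₂-uid , _) | inj₂ (0<i₃ , u₃-uid , _) =
      between i₂<T 0<i₃ u₂-uid u₃-uid e₂ x₃≢b

    a-b-not-hexagonal : ¬ Hexagon (Adj (suc K) N) a b
    a-b-not-hexagonal h =
      no-short-walk (b-neighbour b-x₁ x₁≢a) (a-neighbour x₄-a x₄≢b) x₁-x₂ x₂-x₃ x₃-x₄ x₂≢a x₃≢a x₃≢b
      where open Hexagon h

theorem7 : (k n : ℕ) → 2 ≤ k → 2 ≤ n → ¬ VertexTransitive (Vertex k n) (Adj k n)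
theorem7 (suc (suc m)) (suc (suc n)) _ _ =
  ¬VertexTransitive (origin-hexagonal n (suc m)) a-b a-b-not-hexagonal
  where open BottomTopEdge n m
theorem7 1 _ (s≤s ()) _
theorem7 _ 1 _ (s≤s ())
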